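{- All strings $x,y,z\in \Sigma^*$ satisfy $\mathsf{fold}(x\overline{z}) = \mathsf{fold}(x\overline{y}y\overline{z})\le \mathsf{fold}(x\overline{y})+\mathsf{fold}(y\overline{z})$.
   Context: $\Sigma$ carries a fixed-point-free involution $a\mapsto\overline{a}$, extended to strings by $\overline{x[1]\cdots x[n]}=\overline{x[n]}\cdots\overline{x[1]}$. The folding language $\mathsf{FOLD}(\Sigma)$ is generated by the grammar $S\to SS\mid\varnothing\mid aS\overline{a}$ ($a\in\Sigma$), and $\mathsf{fold}(x)$ is the minimum number of character deletions transforming $x$ into a string of $\mathsf{FOLD}(\Sigma)$. Juxtaposition denotes concatenation. -}

module Defs where

open import Data.List using (List; []; _∷_; _++_; [_]; reverse; map; length)
open import Data.List.Relation.Binary.Sublist.Propositional using (_⊆_)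
open import Data.Nat using (ℕ; _+_; _≤_)
open import Data.Product using (Σ; ∃; _×_)
open import Relation.Binary.PropositionalEquality using (_≡_; _≢_)

record InvAlphabet : Set₁ where
  field
    Sym         : Set
    bar         : Sym → Sym
    involutive  : ∀ a → bar (bar a) ≡ a
    fixpt-free  : ∀ a → bar a ≢ a

module _ (A : InvAlphabet) where
  open InvAlphabet A

  barS : List Sym → List Sym
  barS x = reverse (map bar x)

  data FOLD : List Sym → Set where
    empty : FOLD []
    cat   : ∀ {u v} → FOLD u → FOLD v → FOLD (u ++ v)
    wrap  : ∀ {u} a → FOLD u → FOLD (a ∷ (u ++ [ bar a ]))

  FoldableWith : List Sym → ℕ → Set
  FoldableWith x k = Σ (List Sym) λ y → y ⊆ x × FOLD y × length x ≡ k + length y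

  FoldIs : List Sym → ℕ → Set
  FoldIs x k = FoldableWith x k × (∀ m → FoldableWith x m → k ≤ m)

-- A word lies in FOLD(Σ) exactly when a pushdown automaton, which pushes each
-- letter or lets it pop the stack symbol it closes, can read it from and back
-- to the empty stack. Reading words this way makes positional surgery easy:
-- deleting an adjacent pair c c̄ from a folded word leaves a folded word, and
-- deleting a single letter of a folded word leaves one that folds after
-- deleting one further letter (its partner). Hence deleting the adjacent pair
-- ā a from any word does not increase its fold number, and removing ȳ y one
-- pair at a time gives fold(x z̄) ≤ fold(x ȳ y z̄). Conversely ȳ y ∈ FOLD may be
-- inserted into the folded remainder of x z̄, and the folded remainders of
-- x ȳ and y z̄ concatenate.
module Submission where

open import Defs
open import Data.List using (List; _++_)
open import Data.Nat using (ℕ; _+_; _≤_)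
open import Data.Product using (_×_)
open import Relation.Binary.PropositionalEquality using (_≡_)

open import Data.Fin using (Fin; zero; suc)
open import Data.List using ([]; _∷_; [_]; length; map; removeAt)
open import Data.List.Properties using (++-assoc; ++-identityʳ; length-++; length-removeAt′; unfold-reverse)
open import Data.List.Relation.Binary.Sublist.Propositional using (_⊆_; []; _∷_; _∷ʳ_; ⊆-refl; ⊆-trans)
open import Data.List.Relation.Binary.Sublist.Propositional.Properties using (++⁺; length-mono-≤)
import Data.Nat as ℕ
open import Data.Nat.Properties
  using (+-commutativeSemigroup; +-suc; +-comm; +-mono-≤; +-monoʳ-≤; +-cancelˡ-≤; m≤n+m; m≤n+o⇒m∸n≤o; m∸n+n≡m;
         ≤-antisym; ≤-trans; ≤-reflexive; module ≤-Reasoning)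
open import Data.Product using (Σ; _,_)
open import Data.Sum using (_⊎_; inj₁; inj₂)
open import Relation.Binary.PropositionalEquality using (refl; sym; trans; cong; subst)
open import Algebra.Properties.CommutativeSemigroup +-commutativeSemigroup using (interchange; x∙yz≈y∙xz)

module _ {X : Set} where

  length-++-middle : ∀ (u m v : List X) → length (u ++ m ++ v) ≡ length m + length (u ++ v)
  length-++-middle []      m v = length-++ m
  length-++-middle (x ∷ u) m v = trans (cong ℕ.suc (length-++-middle u m v)) (sym (+-suc _ _))

  removeAt-⊆ : ∀ (w : List X) j → removeAt w j ⊆ w
  removeAt-⊆ (x ∷ w) zero    = x ∷ʳ ⊆-refl
  removeAt-⊆ (x ∷ w) (suc j) = refl ∷ removeAt-⊆ w j

  ⊆-++-split : ∀ (u : List X) {v w} → w ⊆ u ++ v →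
    Σ (List X) λ w₁ → Σ (List X) λ w₂ → w ≡ w₁ ++ w₂ × w₁ ⊆ u × w₂ ⊆ v
  ⊆-++-split []      sub = [] , _ , refl , [] , sub
  ⊆-++-split (x ∷ u) (.x ∷ʳ sub) with ⊆-++-split u sub
  ... | w₁ , w₂ , refl , sub₁ , sub₂ = w₁ , w₂ , refl , x ∷ʳ sub₁ , sub₂
  ⊆-++-split (x ∷ u) (refl ∷ sub) with ⊆-++-split u sub
  ... | w₁ , w₂ , refl , sub₁ , sub₂ = x ∷ w₁ , w₂ , refl , refl ∷ sub₁ , sub₂

module Folding (A : InvAlphabet) where
  open InvAlphabet A

  bar-swap : ∀ {c d} → d ≡ bar c → c ≡ bar d
  bar-swap {c} refl = sym (involutive c)

  -- The stack is listed top first and Accepts s w means reverse s ++ w ∈ FOLD.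
  -- Equality on Sym need not be decidable, so a letter may be pushed even when it could pop.
  data Accepts : List Sym → List Sym → Set where
    done : Accepts [] []
    push : ∀ {s w} a → Accepts (a ∷ s) w → Accepts s (a ∷ w)
    pop  : ∀ {c s w} a → c ≡ bar a → Accepts s w → Accepts (c ∷ s) (a ∷ w)

  FOLD-++-Accepts : ∀ {m s w} → FOLD A m → Accepts s w → Accepts s (m ++ w)
  FOLD-++-Accepts empty r = r
  FOLD-++-Accepts {w = w} (cat {u} {v} f g) r =
    subst (Accepts _) (sym (++-assoc u v w)) (FOLD-++-Accepts f (FOLD-++-Accepts g r))
  FOLD-++-Accepts {w = w} (wrap {u} a f) r =
    subst (λ t → Accepts _ (a ∷ t)) (sym (++-assoc u [ bar a ] w))
      (push a (FOLD-++-Accepts f (pop (bar a) (sym (involutive a)) r)))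

  FOLD⇒Accepts : ∀ {w} → FOLD A w → Accepts [] w
  FOLD⇒Accepts {w} f = subst (Accepts []) (++-identityʳ w) (FOLD-++-Accepts f done)

  Accepts-insert : ∀ {s} u {v m} → Accepts s (u ++ v) → FOLD A m → Accepts s (u ++ m ++ v)
  Accepts-insert []      r          f = FOLD-++-Accepts f r
  Accepts-insert (a ∷ u) (push .a r)  f = push a (Accepts-insert u r f)
  Accepts-insert (a ∷ u) (pop .a e r) f = pop a e (Accepts-insert u r f)

  data Closes : List Sym → List Sym → Set where
    folded : ∀ {w} → FOLD A w → Closes [] w
    close  : ∀ {c s f g} a → FOLD A f → c ≡ bar a → Closes s g → Closes (c ∷ s) (f ++ a ∷ g)

  FOLD-++-Closes : ∀ {s h g} → FOLD A h → Closes s g → Closes s (h ++ g)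
  FOLD-++-Closes fh (folded fg) = folded (cat fh fg)
  FOLD-++-Closes {h = h} fh (close {f = f} {g} a ff e cg) =
    subst (Closes _) (++-assoc h f (a ∷ g)) (close a (cat fh ff) e cg)

  Accepts⇒Closes : ∀ {s w} → Accepts s w → Closes s w
  Accepts⇒Closes done        = folded empty
  Accepts⇒Closes (pop a e r) = close a empty e (Accepts⇒Closes r)
  Accepts⇒Closes (push a r) with Accepts⇒Closes r
  ... | close {f = f} {g} a′ ff e cg = subst (Closes _) reassoc (FOLD-++-Closes (wrap a ff) cg)
    where
    reassoc : (a ∷ f ++ [ bar a ]) ++ g ≡ a ∷ f ++ a′ ∷ g
    reassoc = cong (a ∷_) (trans (++-assoc f [ bar a ] g) (cong (λ b → f ++ b ∷ g) (sym (bar-swap e))))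

  Accepts⇒FOLD : ∀ {w} → Accepts [] w → FOLD A w
  Accepts⇒FOLD r with Accepts⇒Closes r
  ... | folded f = f

  FOLD-insert : ∀ u {v m} → FOLD A (u ++ v) → FOLD A m → FOLD A (u ++ m ++ v)
  FOLD-insert u f g = Accepts⇒FOLD (Accepts-insert u (FOLD⇒Accepts f) g)

  data CancelStep : List Sym → List Sym → Set where
    here  : ∀ {c d s} → d ≡ bar c → CancelStep (c ∷ d ∷ s) s
    there : ∀ {s s′} a → CancelStep s s′ → CancelStep (a ∷ s) (a ∷ s′)

  Accepts-cancelStack : ∀ {s s′ w} → CancelStep s s′ → Accepts s w → Accepts s′ w
  Accepts-cancelStack ()           done
  Accepts-cancelStack st           (push a r)  = push a (Accepts-cancelStack (there a st) r)
  Accepts-cancelStack (there _ st) (pop a e r) = pop a e (Accepts-cancelStack st r)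
  Accepts-cancelStack (here e′)    (pop a e r) =
    push a (subst (λ d → Accepts (d ∷ _) _) (trans e′ (sym (bar-swap e))) r)

  Accepts-cancel : ∀ {s} u {c d v} → d ≡ bar c → Accepts s (u ++ c ∷ d ∷ v) →
    Accepts s (u ++ v) ⊎ Σ (List Sym) λ s′ → CancelStep s s′ × Accepts s′ (u ++ v)
  Accepts-cancel [] e (push c (push d r))    = inj₁ (Accepts-cancelStack (here (bar-swap e)) r)
  Accepts-cancel [] e (push c (pop d _ r))   = inj₁ r
  Accepts-cancel [] e (pop c e₁ (push d r))  = inj₁ (subst (λ y → Accepts (y ∷ _) _) (trans e (sym e₁)) r)
  Accepts-cancel [] e (pop c e₁ (pop d e₂ r)) =
    inj₂ (_ , here (trans e₂ (trans (sym (bar-swap e)) (bar-swap e₁))) , r)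
  Accepts-cancel (x ∷ u) e (push .x r) with Accepts-cancel u e r
  ... | inj₁ r′                    = inj₁ (push x r′)
  ... | inj₂ (_ , here e′ , r′)    = inj₁ (pop x e′ r′)
  ... | inj₂ (_ , there _ st , r′) = inj₂ (_ , st , push x r′)
  Accepts-cancel (x ∷ u) e (pop {c = y} .x e₁ r) with Accepts-cancel u e r
  ... | inj₁ r′            = inj₁ (pop x e₁ r′)
  ... | inj₂ (_ , st , r′) = inj₂ (_ , there y st , pop x e₁ r′)

  FOLD-cancel : ∀ u {c d v} → d ≡ bar c → FOLD A (u ++ c ∷ d ∷ v) → FOLD A (u ++ v)
  FOLD-cancel u e f with Accepts-cancel u e (FOLD⇒Accepts f)
  ... | inj₁ r            = Accepts⇒FOLD r
  ... | inj₂ (_ , () , _)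

  Accepts-removeStack : ∀ {s w} → Accepts s w → (i : Fin (length s)) →
    Σ (Fin (length w)) λ j → Accepts (removeAt s i) (removeAt w j)
  Accepts-removeStack done ()
  Accepts-removeStack (push a r) i with Accepts-removeStack r (suc i)
  ... | j , r′ = suc j , push a r′
  Accepts-removeStack (pop a e r) zero = zero , r
  Accepts-removeStack (pop a e r) (suc i) with Accepts-removeStack r i
  ... | j , r′ = suc j , pop a e r′

  Accepts-remove : ∀ {s} u {b v} → Accepts s (u ++ b ∷ v) →
    (Σ (Fin (length (u ++ v))) λ j → Accepts s (removeAt (u ++ v) j))
    ⊎ (Σ (Fin (length s)) λ i → Accepts (removeAt s i) (u ++ v))
  Accepts-remove [] (push b r)  = inj₁ (Accepts-removeStack r zero)
  Accepts-remove [] (pop b e r) = inj₂ (zero , r)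
  Accepts-remove (x ∷ u) (push .x r) with Accepts-remove u r
  ... | inj₁ (j , r′)     = inj₁ (suc j , push x r′)
  ... | inj₂ (zero , r′)  = inj₁ (zero , r′)
  ... | inj₂ (suc i , r′) = inj₂ (i , push x r′)
  Accepts-remove (x ∷ u) (pop .x e r) with Accepts-remove u r
  ... | inj₁ (j , r′) = inj₁ (suc j , pop x e r′)
  ... | inj₂ (i , r′) = inj₂ (suc i , pop x e r′)

  FOLD-remove : ∀ u {b v} → FOLD A (u ++ b ∷ v) → Σ (Fin (length (u ++ v))) λ j → FOLD A (removeAt (u ++ v) j)
  FOLD-remove u f with Accepts-remove u (FOLD⇒Accepts f)
  ... | inj₁ (j , r)  = j , Accepts⇒FOLD r
  ... | inj₂ (() , _)

  FoldableWithin : List Sym → ℕ → Set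
  FoldableWithin x k = Σ (List Sym) λ y → y ⊆ x × FOLD A y × length x ≤ k + length y

  FoldIs⇒FoldableWithin : ∀ {x k} → FoldIs A x k → FoldableWithin x k
  FoldIs⇒FoldableWithin ((y , sub , f , eq) , _) = y , sub , f , ≤-reflexive eq

  FoldIs-minimal : ∀ {x k m} → FoldIs A x k → FoldableWithin x m → k ≤ m
  FoldIs-minimal {x} {m = m} (_ , minimal) (y , sub , f , le) =
    ≤-trans (minimal _ (y , sub , f , sym (m∸n+n≡m (length-mono-≤ sub))))
            (m≤n+o⇒m∸n≤o (length x) (length y) (≤-trans le (≤-reflexive (+-comm m (length y)))))

  FoldableWithin-++ : ∀ {u v k l} → FoldableWithin u k → FoldableWithin v l → FoldableWithin (u ++ v) (k + l)
  FoldableWithin-++ {u} {v} {k} {l} (y₁ , sub₁ , f₁ , le₁) (y₂ , sub₂ , f₂ , le₂) =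
    y₁ ++ y₂ , ++⁺ sub₁ sub₂ , cat f₁ f₂ , le
    where
    open ≤-Reasoning
    le : length (u ++ v) ≤ (k + l) + length (y₁ ++ y₂)
    le = begin
      length (u ++ v)                        ≡⟨ length-++ u ⟩
      length u + length v                    ≤⟨ +-mono-≤ le₁ le₂ ⟩
      (k + length y₁) + (l + length y₂)      ≡⟨ interchange k (length y₁) l (length y₂) ⟩
      (k + l) + (length y₁ + length y₂)      ≡⟨ cong ((k + l) +_) (sym (length-++ y₁)) ⟩
      (k + l) + length (y₁ ++ y₂)            ∎

  FoldableWithin-insert : ∀ u {v m k} → FoldableWithin (u ++ v) k → FOLD A m → FoldableWithin (u ++ m ++ v) k
  FoldableWithin-insert u {v} {m} {k} (y , sub , f , le) g with ⊆-++-split u sub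
  ... | y₁ , y₂ , refl , sub₁ , sub₂ =
    y₁ ++ m ++ y₂ , ++⁺ sub₁ (++⁺ ⊆-refl sub₂) , FOLD-insert y₁ f g , le′
    where
    open ≤-Reasoning
    le′ : length (u ++ m ++ v) ≤ k + length (y₁ ++ m ++ y₂)
    le′ = begin
      length (u ++ m ++ v)               ≡⟨ length-++-middle u m v ⟩
      length m + length (u ++ v)         ≤⟨ +-monoʳ-≤ (length m) le ⟩
      length m + (k + length (y₁ ++ y₂)) ≡⟨ x∙yz≈y∙xz (length m) k _ ⟩
      k + (length m + length (y₁ ++ y₂)) ≡⟨ cong (k +_) (sym (length-++-middle y₁ m y₂)) ⟩
      k + length (y₁ ++ m ++ y₂)         ∎

  FOLD-⊆-removeOne : ∀ w₁ {b w₂ u v} → w₁ ⊆ u → w₂ ⊆ v → FOLD A (w₁ ++ b ∷ w₂) →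
    Σ (List Sym) λ w → w ⊆ u ++ v × FOLD A w × length (w₁ ++ b ∷ w₂) ≤ 2 + length w
  FOLD-⊆-removeOne w₁ {b} {w₂} sub₁ sub₂ f with FOLD-remove w₁ f
  ... | j , f′ =
    removeAt (w₁ ++ w₂) j , ⊆-trans (removeAt-⊆ _ j) (++⁺ sub₁ sub₂) , f′ ,
    ≤-reflexive (trans (length-++-middle w₁ [ b ] w₂) (cong ℕ.suc (length-removeAt′ (w₁ ++ w₂) j)))

  FOLD-⊆-cancel : ∀ u {c d v w} → d ≡ bar c → w ⊆ u ++ c ∷ d ∷ v → FOLD A w →
    Σ (List Sym) λ w′ → w′ ⊆ u ++ v × FOLD A w′ × length w ≤ 2 + length w′
  FOLD-⊆-cancel u e sub f with ⊆-++-split u sub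
  ... | w₁ , w₂ , refl , sub₁ , _ ∷ʳ _ ∷ʳ sub₂   = w₁ ++ w₂ , ++⁺ sub₁ sub₂ , f , m≤n+m _ 2
  ... | w₁ , _ , refl , sub₁ , _ ∷ʳ refl ∷ sub₂  = FOLD-⊆-removeOne w₁ sub₁ sub₂ f
  ... | w₁ , _ , refl , sub₁ , refl ∷ _ ∷ʳ sub₂  = FOLD-⊆-removeOne w₁ sub₁ sub₂ f
  ... | w₁ , _ ∷ _ ∷ w₂ , refl , sub₁ , refl ∷ refl ∷ sub₂ =
    w₁ ++ w₂ , ++⁺ sub₁ sub₂ , FOLD-cancel w₁ e f , ≤-reflexive (length-++-middle w₁ (_ ∷ _ ∷ []) w₂)

  FoldableWithin-cancel : ∀ u {c d v k} → d ≡ bar c → FoldableWithin (u ++ c ∷ d ∷ v) k → FoldableWithin (u ++ v) k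
  FoldableWithin-cancel u {c} {d} {v} {k} e (w , sub , f , le) with FOLD-⊆-cancel u e sub f
  ... | w′ , sub′ , f′ , shrink = w′ , sub′ , f′ , +-cancelˡ-≤ 2 _ _ le′
    where
    open ≤-Reasoning
    le′ : 2 + length (u ++ v) ≤ 2 + (k + length w′)
    le′ = begin
      2 + length (u ++ v)      ≡⟨ length-++-middle u (c ∷ d ∷ []) v ⟨
      length (u ++ c ∷ d ∷ v)  ≤⟨ le ⟩
      k + length w             ≤⟨ +-monoʳ-≤ k shrink ⟩
      k + (2 + length w′)      ≡⟨ x∙yz≈y∙xz k 2 _ ⟩
      2 + (k + length w′)      ∎

  barS-∷-++ : ∀ a y t → barS A (a ∷ y) ++ a ∷ t ≡ barS A y ++ bar a ∷ a ∷ t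
  barS-∷-++ a y t = trans (cong (_++ a ∷ t) (unfold-reverse (bar a) (map bar y)))
                          (++-assoc (barS A y) [ bar a ] (a ∷ t))

  FoldableWithin-cancel-barS : ∀ x y q {k} → FoldableWithin (x ++ barS A y ++ y ++ q) k → FoldableWithin (x ++ q) k
  FoldableWithin-cancel-barS x []      q fw = fw
  FoldableWithin-cancel-barS x (a ∷ y) q {k} fw =
    FoldableWithin-cancel-barS x y q
      (subst (λ w → FoldableWithin w k) (++-assoc x (barS A y) (y ++ q))
        (FoldableWithin-cancel (x ++ barS A y) (sym (involutive a))
          (subst (λ w → FoldableWithin w k) reassoc fw)))
    where
    reassoc : x ++ barS A (a ∷ y) ++ a ∷ y ++ q ≡ (x ++ barS A y) ++ bar a ∷ a ∷ y ++ q
    reassoc = trans (cong (x ++_) (barS-∷-++ a y (y ++ q))) (sym (++-assoc x (barS A y) _))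

  FOLD-barS-++ : ∀ y → FOLD A (barS A y ++ y)
  FOLD-barS-++ []      = empty
  FOLD-barS-++ (a ∷ y) = subst (FOLD A) (sym (barS-∷-++ a y y)) (FOLD-insert (barS A y) (FOLD-barS-++ y) pair)
    where
    pair : FOLD A (bar a ∷ a ∷ [])
    pair = subst (λ b → FOLD A (bar a ∷ b ∷ [])) (involutive a) (wrap (bar a) empty)

lemma6p4 : (A : InvAlphabet) (x y z : List (InvAlphabet.Sym A)) (k₁ k₂ k₃ k₄ : ℕ) →
    FoldIs A (x ++ barS A z) k₁ →
    FoldIs A (x ++ barS A y ++ y ++ barS A z) k₂ →
    FoldIs A (x ++ barS A y) k₃ →
    FoldIs A (y ++ barS A z) k₄ →
    (k₁ ≡ k₂) × (k₂ ≤ k₃ + k₄)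
lemma6p4 A x y z k₁ k₂ k₃ k₄ fold₁ fold₂ fold₃ fold₄ = ≤-antisym k₁≤k₂ k₂≤k₁ , k₂≤k₃+k₄
  where
  open Folding A
  z̄ = barS A z

  k₁≤k₂ : k₁ ≤ k₂
  k₁≤k₂ = FoldIs-minimal fold₁ (FoldableWithin-cancel-barS x y z̄ (FoldIs⇒FoldableWithin fold₂))

  k₂≤k₁ : k₂ ≤ k₁
  k₂≤k₁ = FoldIs-minimal fold₂
    (subst (λ w → FoldableWithin w k₁) (cong (x ++_) (++-assoc (barS A y) y z̄))
      (FoldableWithin-insert x (FoldIs⇒FoldableWithin fold₁) (FOLD-barS-++ y)))

  k₂≤k₃+k₄ : k₂ ≤ k₃ + k₄
  k₂≤k₃+k₄ = FoldIs-minimal fold₂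
    (subst (λ w → FoldableWithin w (k₃ + k₄)) (++-assoc x (barS A y) (y ++ z̄))
      (FoldableWithin-++ (FoldIs⇒FoldableWithin fold₃) (FoldIs⇒FoldableWithin fold₄)))
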